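{- There exists a $1$-PDDS$[P_2]$ in $\Lambda_2$ that is periodic but not lattice-like.
   Context: $\Lambda_2$ is the infinite graph with vertex set $\mathbb{Z}^2$ in which two vertices are adjacent iff their Euclidean distance is $1$; $d$ denotes graph distance. For $S$ a set of vertices, $[S]$ is the induced subgraph and $d(v,C)=\min\{d(v,w):w\in C\}$. For $t\ge1$, $S$ is a $t$-perfect distance-dominating set ($t$-PDDS) if for each vertex $v$ there is a unique component $C_v$ of $[S]$ with $d(v,C_v)\le t$, and there is in $C_v$ a unique vertex $w$ with $d(v,w)=d(v,C_v)$. A $t$-PDDS$[H]$ is a $t$-PDDS all of whose components are isomorphic to the fixed finite graph $H$; $P_2$ is the path on 2 vertices. A set $S\subset\mathbb{Z}^2$ is periodic if there are (positive) integers $p_1,p_2$ such that $v\in S$ implies $v\pm p_ie_i\in S$ for $i=1,2$, where $e_i$ are the unit vectors. For a subgraph $D$ and $z\in\mathbb{Z}^2$, $D+z$ is its translate by $z$. A $t$-PDDS$[H]$ $R$ is lattice-like if, for a component $D$ of $R$, there is a lattice $L$ (subgroup of $(\mathbb{Z}^2,+)$) such that $D'$ is a component of $R$ iff $D'=D+z$ for some $z\in L$. -}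

module Defs where

open import Data.Nat using (ℕ; _≤_; _+_)
open import Data.Integer as ℤ using (ℤ; ∣_∣; _-_; +_)
open import Data.Product using (_×_; _,_; Σ; ∃; ∃-syntax)
open import Data.Sum using (_⊎_)
open import Relation.Binary.PropositionalEquality using (_≡_)
open import Relation.Nullary using (¬_)
open import Function.Bundles using (_⇔_)

Point : Set
Point = ℤ × ℤ

_⊕_ : Point → Point → Point
(a , b) ⊕ (c , d) = (a ℤ.+ c , b ℤ.+ d)

_⊖_ : Point → Point → Point
(a , b) ⊖ (c , d) = (a - c , b - d)

⊝_ : Point → Point
⊝ (a , b) = (ℤ.- a , ℤ.- b)

origin : Point
origin = (+ 0 , + 0)

-- Graph distance in Λ₂ (the L¹ / Manhattan distance)
dist : Point → Point → ℕ
dist (a , b) (c , d) = ∣ a - c ∣ + ∣ b - d ∣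

Adj : Point → Point → Set
Adj v w = dist v w ≡ 1

VSet : Set₁
VSet = Point → Set

data Conn (S : VSet) : Point → Point → Set where
  here : ∀ {v} → S v → Conn S v v
  step : ∀ {u v w} → Conn S u v → Adj v w → S w → Conn S u w

-- t-perfect distance-dominating set: for every vertex v there is w ∈ S with
-- d(v,w) ≤ t such that (i) every w' ∈ S with d(v,w') ≤ t lies in the
-- component C_v of w (uniqueness of C_v), and (ii) w is the unique vertex of
-- C_v at minimal distance from v.
IsPDDS : ℕ → VSet → Set
IsPDDS t S = ∀ v → ∃[ w ] (S w × dist v w ≤ t
  × (∀ w' → S w' → dist v w' ≤ t → Conn S w w')
  × (∀ w' → Conn S w w' → dist v w' ≤ dist v w → w' ≡ w))

-- Every component of [S] is isomorphic to P₂: the component of each v ∈ S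
-- is exactly {v, w} for some neighbour w of v.
ComponentsP2 : VSet → Set
ComponentsP2 S = ∀ v → S v → ∃[ w ] (Adj v w × S w
  × (∀ u → Conn S v u ⇔ (u ≡ v ⊎ u ≡ w)))

IsPDDS[P2] : ℕ → VSet → Set
IsPDDS[P2] t S = IsPDDS t S × ComponentsP2 S

e₁ e₂ : ℕ → Point
e₁ p = (+ p , + 0)
e₂ p = (+ 0 , + p)

Periodic : VSet → Set
Periodic S = ∃[ p₁ ] ∃[ p₂ ] (1 ≤ p₁ × 1 ≤ p₂ ×
  (∀ v → S v → S (v ⊕ e₁ p₁) × S (v ⊖ e₁ p₁) × S (v ⊕ e₂ p₂) × S (v ⊖ e₂ p₂)))

IsLattice : VSet → Set
IsLattice L = L origin × (∀ x y → L x → L y → L (x ⊕ y)) × (∀ x → L x → L (⊝ x))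

-- Lattice-like: for a component D (that of a ∈ S) there is a lattice L such that
-- D' is a component of [S] iff D' = D + z for some z ∈ L.
-- Components are represented as {u | Conn S a' u} for a' ∈ S; D + z = {u | u - z ∈ D}.
LatticeLike : VSet → Set₁
LatticeLike S = ∃[ a ] (S a × Σ VSet λ L → IsLattice L
  × (∀ a' → S a' → ∃[ z ] (L z × (∀ u → Conn S a' u ⇔ Conn S a (u ⊖ z))))
  × (∀ z → L z → ∃[ a' ] (S a' × (∀ u → Conn S a' u ⇔ Conn S a (u ⊖ z)))))

-- A set S ⊆ ℤ² such that every vertex has exactly one neighbour in S (a total perfect
-- code) is a 1-PDDS[P₂]: a vertex of S is dominated by itself and its unique S-neighbour
-- is its domino partner, while a vertex outside S sees exactly one vertex of S, whose
-- partner is at distance 2 because Λ₂ has no triangles. An 8 × 8 tile yields a periodic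
-- total perfect code containing both horizontal and vertical dominoes. In a lattice-like
-- set all components are translates of one domino, so the displacement within every
-- domino is the same up to sign; hence this set is not lattice-like.
module Submission where

open import Data.Bool using (Bool; true; false; T)
open import Data.Unit using (tt)
open import Data.Empty using (⊥-elim)
open import Data.Fin using (Fin)
open import Data.Fin.Patterns using (0F; 1F; 2F; 3F; 4F; 5F; 6F; 7F)
open import Data.Fin.Properties using (any?; all?) renaming (_≟_ to _≟ᶠ_)
open import Data.Integer as ℤ using (ℤ; +_; -[1+_]; ∣_∣; 1ℤ)
import Data.Integer.Properties as ℤP
open import Data.Integer.Tactic.RingSolver using (solve-∀)
open import Data.Nat as ℕ using (ℕ; zero; suc; _≤_; _≤?_; z≤n; s≤s)
import Data.Nat.Properties as ℕP
open import Data.Nat.GeneralisedArithmetic using (iterate)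
open import Data.Product using (Σ; _×_; _,_; proj₁; proj₂; ∃-syntax)
open import Data.Product.Properties using (≡-dec)
open import Data.Sum using (_⊎_; inj₁; inj₂)
open import Data.Vec using (Vec; []; _∷_; lookup)
open import Function.Base using (_∘_)
open import Function.Bundles using (mk⇔; Equivalence)
open import Relation.Binary.Definitions using (DecidableEquality)
open import Relation.Binary.PropositionalEquality
open import Relation.Nullary using (¬_; yes; no; contradiction)
open import Relation.Nullary.Decidable using (from-yes; T?; _×-dec_; _→-dec_)
open import Relation.Unary using (Decidable)

open import Defs

open ≡-Reasoning

⊕-assoc : ∀ v z z′ → (v ⊕ z) ⊕ z′ ≡ v ⊕ (z ⊕ z′)
⊕-assoc (a , b) (i , j) (i′ , j′) = cong₂ _,_ (ℤP.+-assoc a i i′) (ℤP.+-assoc b j j′)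

⊕-identityʳ : ∀ v → v ⊕ origin ≡ v
⊕-identityʳ (a , b) = cong₂ _,_ (ℤP.+-identityʳ a) (ℤP.+-identityʳ b)

⊕-⊖-cancel : ∀ v z → (v ⊕ z) ⊖ v ≡ z
⊕-⊖-cancel (a , b) (i , j) = cong₂ _,_ (cancel a i) (cancel b j)
  where
  cancel : ∀ a i → (a ℤ.+ i) ℤ.- a ≡ i
  cancel = solve-∀

⊖-⊕-cancel : ∀ v z → v ⊖ (v ⊕ z) ≡ ⊝ z
⊖-⊕-cancel (a , b) (i , j) = cong₂ _,_ (cancel a i) (cancel b j)
  where
  cancel : ∀ a i → a ℤ.- (a ℤ.+ i) ≡ ℤ.- i
  cancel = solve-∀

⊕-⊖ : ∀ v w → v ⊕ (w ⊖ v) ≡ w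
⊕-⊖ (a , b) (c , d) = cong₂ _,_ (cancel a c) (cancel b d)
  where
  cancel : ∀ a c → a ℤ.+ (c ℤ.- a) ≡ c
  cancel = solve-∀

⊕-⊖-comm : ∀ v z t → (v ⊕ z) ⊖ t ≡ (v ⊖ t) ⊕ z
⊕-⊖-comm (a , b) (i , j) (k , l) = cong₂ _,_ (comm a i k) (comm b j l)
  where
  comm : ∀ a i k → (a ℤ.+ i) ℤ.- k ≡ (a ℤ.- k) ℤ.+ i
  comm = solve-∀

⊝-involutive : ∀ z → ⊝ ⊝ z ≡ z
⊝-involutive (i , j) = cong₂ _,_ (ℤP.neg-involutive i) (ℤP.neg-involutive j)

⊝-injective : ∀ {z z′} → ⊝ z ≡ ⊝ z′ → z ≡ z′
⊝-injective {z} {z′} eq = begin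
  z     ≡⟨ ⊝-involutive z ⟨
  ⊝ ⊝ z  ≡⟨ cong ⊝_ eq ⟩
  ⊝ ⊝ z′ ≡⟨ ⊝-involutive z′ ⟩
  z′    ∎

infix 4 _≟_
_≟_ : DecidableEquality Point
_≟_ = ≡-dec ℤ._≟_ ℤ._≟_

norm : Point → ℕ
norm (i , j) = ∣ i ∣ ℕ.+ ∣ j ∣

Dir : Set
Dir = Fin 4

unit : Dir → Point
unit 0F = (+ 1 , + 0)
unit 1F = (+ 0 , + 1)
unit 2F = (-[1+ 0 ] , + 0)
unit 3F = (+ 0 , -[1+ 0 ])

norm-unit : ∀ d → norm (unit d) ≡ 1
norm-unit 0F = refl
norm-unit 1F = refl
norm-unit 2F = refl
norm-unit 3F = refl

norm≤1 : ∀ z → norm z ≤ 1 → z ≡ origin ⊎ ∃[ d ] z ≡ unit d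
norm≤1 (+ 0 , + 0) _ = inj₁ refl
norm≤1 (+ 1 , + 0) _ = inj₂ (0F , refl)
norm≤1 (+ 0 , + 1) _ = inj₂ (1F , refl)
norm≤1 (-[1+ 0 ] , + 0) _ = inj₂ (2F , refl)
norm≤1 (+ 0 , -[1+ 0 ]) _ = inj₂ (3F , refl)
norm≤1 (+ 0 , + suc (suc _)) (s≤s ())
norm≤1 (+ 0 , -[1+ suc _ ]) (s≤s ())
norm≤1 (+ 1 , + suc _) (s≤s ())
norm≤1 (+ 1 , -[1+ _ ]) (s≤s ())
norm≤1 (-[1+ 0 ] , + suc _) (s≤s ())
norm≤1 (-[1+ 0 ] , -[1+ _ ]) (s≤s ())
norm≤1 (+ suc (suc _) , _) (s≤s ())
norm≤1 (-[1+ suc _ ] , _) (s≤s ())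

unit-sum-norm≤1⇒origin : ∀ d e → norm (unit d ⊕ unit e) ≤ 1 → unit d ⊕ unit e ≡ origin
unit-sum-norm≤1⇒origin = from-yes (all? λ d → all? λ e →
  (norm (unit d ⊕ unit e) ≤? 1) →-dec (unit d ⊕ unit e ≟ origin))

dist-comm : ∀ v w → dist v w ≡ dist w v
dist-comm (a , b) (c , d) = cong₂ ℕ._+_ (ℤP.∣i-j∣≡∣j-i∣ a c) (ℤP.∣i-j∣≡∣j-i∣ b d)

dist-⊕ : ∀ v z → dist v (v ⊕ z) ≡ norm z
dist-⊕ v z = trans (dist-comm v (v ⊕ z)) (cong norm (⊕-⊖-cancel v z))

dist-self : ∀ v → dist v v ≡ 0
dist-self v = trans (cong (dist v) (sym (⊕-identityʳ v))) (dist-⊕ v origin)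

adj-sym : ∀ v w → Adj v w → Adj w v
adj-sym v w adj = trans (dist-comm w v) adj

v⊕z≢v : ∀ {z} v → norm z ≡ 1 → v ⊕ z ≢ v
v⊕z≢v {z} v ∣z∣≡1 eq = contradiction (begin
  0               ≡⟨ dist-self v ⟨
  dist v v        ≡⟨ cong (dist v) eq ⟨
  dist v (v ⊕ z)  ≡⟨ dist-⊕ v z ⟩
  norm z          ≡⟨ ∣z∣≡1 ⟩
  1               ∎) λ ()

≤1⇒≡⊎adj : ∀ v w → dist v w ≤ 1 → w ≡ v ⊎ Adj v w
≤1⇒≡⊎adj v w h with norm≤1 (w ⊖ v) (subst (_≤ 1) (dist-comm v w) h)
... | inj₁ w⊖v≡0 = inj₁ (begin
  w               ≡⟨ ⊕-⊖ v w ⟨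
  v ⊕ (w ⊖ v)     ≡⟨ cong (v ⊕_) w⊖v≡0 ⟩
  v ⊕ origin      ≡⟨ ⊕-identityʳ v ⟩
  v               ∎)
... | inj₂ (d , w⊖v≡u) = inj₂ (trans (dist-comm v w) (trans (cong norm w⊖v≡u) (norm-unit d)))

adj⇒unit-step : ∀ v w → Adj v w → ∃[ d ] w ≡ v ⊕ unit d
adj⇒unit-step v w adj with norm≤1 (w ⊖ v) (ℕP.≤-reflexive (trans (dist-comm w v) adj))
... | inj₁ w⊖v≡0 = contradiction (trans (sym (cong norm w⊖v≡0)) (trans (dist-comm w v) adj)) λ ()
... | inj₂ (d , w⊖v≡u) = d , trans (sym (⊕-⊖ v w)) (cong (v ⊕_) w⊖v≡u)

-- Λ₂ has no triangles.
no-short-return : ∀ {u v w} → Adj u v → Adj v w → dist u w ≤ 1 → w ≡ u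
no-short-return {u} {v} {w} uv vw h with adj⇒unit-step u v uv | adj⇒unit-step v w vw
... | d , refl | e , refl = begin
  (u ⊕ unit d) ⊕ unit e  ≡⟨ ⊕-assoc u (unit d) (unit e) ⟩
  u ⊕ (unit d ⊕ unit e)  ≡⟨ cong (u ⊕_) (unit-sum-norm≤1⇒origin d e short) ⟩
  u ⊕ origin             ≡⟨ ⊕-identityʳ u ⟩
  u                      ∎
  where
  short : norm (unit d ⊕ unit e) ≤ 1
  short = subst (_≤ 1) (trans (cong (dist u) (⊕-assoc u (unit d) (unit e))) (dist-⊕ u _)) h

conn-∈ : ∀ {S u w} → Conn S u w → S w
conn-∈ (here w∈S) = w∈S
conn-∈ (step _ _ w∈S) = w∈S

TotalPerfectCode : VSet → Set
TotalPerfectCode S = ∀ v → ∃[ w ] (Adj v w × S w × (∀ w′ → Adj v w′ → S w′ → w′ ≡ w))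

module _ {S : VSet} (code : TotalPerfectCode S) where

  partner : Point → Point
  partner v = proj₁ (code v)

  adj-partner : ∀ v → Adj v (partner v)
  adj-partner v = proj₁ (proj₂ (code v))

  partner-∈ : ∀ v → S (partner v)
  partner-∈ v = proj₁ (proj₂ (proj₂ (code v)))

  adj-∈⇒partner : ∀ v w → Adj v w → S w → w ≡ partner v
  adj-∈⇒partner v w = proj₂ (proj₂ (proj₂ (code v))) w

  partner-involutive : ∀ {v} → S v → partner (partner v) ≡ v
  partner-involutive {v} v∈S =
    sym (adj-∈⇒partner (partner v) v (adj-sym v (partner v) (adj-partner v)) v∈S)

  conn-partner : ∀ {v} → S v → Conn S v (partner v)
  conn-partner {v} v∈S = step (here v∈S) (adj-partner v) (partner-∈ v)

  component : ∀ {v u} → S v → Conn S v u → u ≡ v ⊎ u ≡ partner v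
  component v∈S (here _) = inj₁ refl
  component {v} v∈S (step {w = x} c adj x∈S) with component v∈S c
  ... | inj₁ refl = inj₂ (adj-∈⇒partner v x adj x∈S)
  ... | inj₂ refl = inj₁ (trans (adj-∈⇒partner (partner v) x adj x∈S) (partner-involutive v∈S))

  ≤1-∈⇒≡⊎partner : ∀ v w → S w → dist v w ≤ 1 → w ≡ v ⊎ w ≡ partner v
  ≤1-∈⇒≡⊎partner v w w∈S h with ≤1⇒≡⊎adj v w h
  ... | inj₁ w≡v = inj₁ w≡v
  ... | inj₂ adj = inj₂ (adj-∈⇒partner v w adj w∈S)

  total-perfect-code⇒components-P₂ : ComponentsP2 S
  total-perfect-code⇒components-P₂ v v∈S =
    partner v , adj-partner v , partner-∈ v ,
    λ u → mk⇔ (component v∈S) λ { (inj₁ refl) → here v∈S ; (inj₂ refl) → conn-partner v∈S }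

  total-perfect-code⇒PDDS : Decidable S → IsPDDS 1 S
  total-perfect-code⇒PDDS S? v with S? v
  ... | yes v∈S = v , v∈S , self≤1 , covers , closest
    where
    self≤1 : dist v v ≤ 1
    self≤1 = subst (_≤ 1) (sym (dist-self v)) z≤n
    covers : ∀ w → S w → dist v w ≤ 1 → Conn S v w
    covers w w∈S h with ≤1-∈⇒≡⊎partner v w w∈S h
    ... | inj₁ refl = here v∈S
    ... | inj₂ refl = conn-partner v∈S
    closest : ∀ w → Conn S v w → dist v w ≤ dist v v → w ≡ v
    closest w _ h with ≤1⇒≡⊎adj v w (ℕP.≤-trans h self≤1)
    ... | inj₁ w≡v = w≡v
    ... | inj₂ adj = contradiction (subst₂ _≤_ adj (dist-self v) h) λ ()
  ... | no v∉S = partner v , partner-∈ v , ℕP.≤-reflexive (adj-partner v) , covers , closest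
    where
    covers : ∀ w → S w → dist v w ≤ 1 → Conn S (partner v) w
    covers w w∈S h with ≤1-∈⇒≡⊎partner v w w∈S h
    ... | inj₁ refl = contradiction w∈S v∉S
    ... | inj₂ refl = here (partner-∈ v)
    closest : ∀ w → Conn S (partner v) w → dist v w ≤ dist v (partner v) → w ≡ partner v
    closest w c h with component (partner-∈ v) c
    ... | inj₁ w≡p = w≡p
    ... | inj₂ refl = contradiction (subst S returns (conn-∈ c)) v∉S
      where
      returns : partner (partner v) ≡ v
      returns = no-short-return {v} (adj-partner v) (adj-partner (partner v))
        (subst (dist v (partner (partner v)) ≤_) (adj-partner v) h)

total-perfect-code⇒PDDS[P₂] : ∀ {S} → Decidable S → TotalPerfectCode S → IsPDDS[P2] 1 S
total-perfect-code⇒PDDS[P₂] S? code =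
  total-perfect-code⇒PDDS code S? , total-perfect-code⇒components-P₂ code

pair-displacement : ∀ {S a p x z} → (∀ u → Conn S a u → u ≡ a ⊎ u ≡ p) → norm z ≡ 1 →
  Conn S a x → Conn S a (x ⊕ z) → p ⊖ a ≡ z ⊎ p ⊖ a ≡ ⊝ z
pair-displacement {x = x} {z} comp ∣z∣≡1 ax axz with comp x ax | comp (x ⊕ z) axz
... | inj₁ refl | inj₁ x⊕z≡x = ⊥-elim (v⊕z≢v x ∣z∣≡1 x⊕z≡x)
... | inj₁ refl | inj₂ refl = inj₁ (⊕-⊖-cancel x z)
... | inj₂ refl | inj₁ refl = inj₂ (⊖-⊕-cancel x z)
... | inj₂ refl | inj₂ x⊕z≡x = ⊥-elim (v⊕z≢v x ∣z∣≡1 x⊕z≡x)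

equal-up-to-sign : ∀ {q z z′} → q ≡ z ⊎ q ≡ ⊝ z → q ≡ z′ ⊎ q ≡ ⊝ z′ → z ≡ z′ ⊎ z ≡ ⊝ z′
equal-up-to-sign (inj₁ refl) (inj₁ refl) = inj₁ refl
equal-up-to-sign (inj₁ refl) (inj₂ refl) = inj₂ refl
equal-up-to-sign {z = z} (inj₂ refl) (inj₁ refl) = inj₂ (sym (⊝-involutive z))
equal-up-to-sign (inj₂ refl) (inj₂ eq) = inj₁ (⊝-injective eq)

lattice-like⇒dominoes-parallel : ∀ {S x y z z′} → LatticeLike S → ComponentsP2 S →
  norm z ≡ 1 → S x → S (x ⊕ z) → norm z′ ≡ 1 → S y → S (y ⊕ z′) → z ≡ z′ ⊎ z ≡ ⊝ z′
lattice-like⇒dominoes-parallel {S} (a , a∈S , _ , _ , translate , _) components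
  ∣z∣≡1 x∈S x⊕z∈S ∣z′∣≡1 y∈S y⊕z′∈S =
  equal-up-to-sign (displacement ∣z∣≡1 x∈S x⊕z∈S) (displacement ∣z′∣≡1 y∈S y⊕z′∈S)
  where
  p : Point
  p = proj₁ (components a a∈S)

  comp : ∀ u → Conn S a u → u ≡ a ⊎ u ≡ p
  comp u = Equivalence.to (proj₂ (proj₂ (proj₂ (components a a∈S))) u)

  displacement : ∀ {x z} → norm z ≡ 1 → S x → S (x ⊕ z) → p ⊖ a ≡ z ⊎ p ⊖ a ≡ ⊝ z
  displacement {x} {z} ∣z∣≡1 x∈S x⊕z∈S with translate x x∈S
  ... | t , _ , x~a = pair-displacement comp ∣z∣≡1 (to (here x∈S))
    (subst (Conn S a) (⊕-⊖-comm x z t) (to (step (here x∈S) (trans (dist-⊕ x z) ∣z∣≡1) x⊕z∈S)))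
    where
    to : ∀ {u} → Conn S x u → Conn S a (u ⊖ t)
    to {u} = Equivalence.to (x~a u)

next prev : Fin 8 → Fin 8
next 0F = 1F
next 1F = 2F
next 2F = 3F
next 3F = 4F
next 4F = 5F
next 5F = 6F
next 6F = 7F
next 7F = 0F
prev 0F = 7F
prev 1F = 0F
prev 2F = 1F
prev 3F = 2F
prev 4F = 3F
prev 5F = 4F
prev 6F = 5F
prev 7F = 6F

prev-next : ∀ i → prev (next i) ≡ i
prev-next = from-yes (all? λ i → prev (next i) ≟ᶠ i)

next-prev : ∀ i → next (prev i) ≡ i
next-prev = from-yes (all? λ i → next (prev i) ≟ᶠ i)

next⁸ : ∀ i → iterate next i 8 ≡ i
next⁸ = from-yes (all? λ i → iterate next i 8 ≟ᶠ i)

residue : ℤ → Fin 8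
residue (+ zero) = 0F
residue (+ suc n) = next (residue (+ n))
residue -[1+ zero ] = 7F
residue -[1+ suc n ] = prev (residue -[1+ n ])

residue-suc : ∀ x → residue (x ℤ.+ 1ℤ) ≡ next (residue x)
residue-suc (+ n) = cong (residue ∘ +_) (ℕP.+-comm n 1)
residue-suc -[1+ zero ] = refl
residue-suc -[1+ suc n ] = sym (next-prev (residue -[1+ n ]))

residue-pred : ∀ x → residue (x ℤ.- 1ℤ) ≡ prev (residue x)
residue-pred x = begin
  residue (x ℤ.- 1ℤ)                     ≡⟨ prev-next _ ⟨
  prev (next (residue (x ℤ.- 1ℤ)))        ≡⟨ cong prev (residue-suc (x ℤ.- 1ℤ)) ⟨
  prev (residue (x ℤ.- 1ℤ ℤ.+ 1ℤ))        ≡⟨ cong (prev ∘ residue) (cancel x) ⟩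
  prev (residue x)                       ∎
  where
  cancel : ∀ x → x ℤ.- 1ℤ ℤ.+ 1ℤ ≡ x
  cancel = solve-∀

residue-+ : ∀ n x → residue (x ℤ.+ + n) ≡ iterate next (residue x) n
residue-+ zero x = cong residue (ℤP.+-identityʳ x)
residue-+ (suc n) x = begin
  residue (x ℤ.+ + suc n)             ≡⟨ cong residue (shuffle n) ⟩
  residue ((x ℤ.+ 1ℤ) ℤ.+ + n)        ≡⟨ residue-+ n (x ℤ.+ 1ℤ) ⟩
  iterate next (residue (x ℤ.+ 1ℤ)) n ≡⟨ cong (λ i → iterate next i n) (residue-suc x) ⟩
  iterate next (next (residue x)) n   ∎
  where
  shuffle : ∀ n → x ℤ.+ + suc n ≡ (x ℤ.+ 1ℤ) ℤ.+ + n
  shuffle n = trans (cong (λ k → x ℤ.+ k) (ℤP.pos-+ 1 n)) (sym (ℤP.+-assoc x 1ℤ (+ n)))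

residue-+8 : ∀ x → residue (x ℤ.+ + 8) ≡ residue x
residue-+8 x = trans (residue-+ 8 x) (next⁸ (residue x))

residue--8 : ∀ x → residue (x ℤ.- + 8) ≡ residue x
residue--8 x = begin
  residue (x ℤ.- + 8)               ≡⟨ residue-+8 (x ℤ.- + 8) ⟨
  residue ((x ℤ.- + 8) ℤ.+ + 8)     ≡⟨ cong residue (cancel x) ⟩
  residue x                         ∎
  where
  cancel : ∀ x → (x ℤ.- + 8) ℤ.+ + 8 ≡ x
  cancel = solve-∀

Residue² : Set
Residue² = Fin 8 × Fin 8

residue² : Point → Residue²
residue² (a , b) = residue a , residue b

shift : Dir → Residue² → Residue²
shift 0F (r , s) = next r , s
shift 1F (r , s) = r , next s
shift 2F (r , s) = prev r , s
shift 3F (r , s) = r , prev s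

residue²-unit : ∀ v d → residue² (v ⊕ unit d) ≡ shift d (residue² v)
residue²-unit (a , b) 0F = cong₂ _,_ (residue-suc a) (residue-+ 0 b)
residue²-unit (a , b) 1F = cong₂ _,_ (residue-+ 0 a) (residue-suc b)
residue²-unit (a , b) 2F = cong₂ _,_ (residue-pred a) (residue-+ 0 b)
residue²-unit (a , b) 3F = cong₂ _,_ (residue-+ 0 a) (residue-pred b)

■ □ : Bool
■ = true
□ = false

-- Row s lists the residues (r , s) for r = 0, …, 7, so the picture is ℤ² upside down.
tile : Vec (Vec Bool 8) 8
tile = (□ ∷ ■ ∷ ■ ∷ □ ∷ □ ∷ □ ∷ □ ∷ □ ∷ [])
     ∷ (□ ∷ □ ∷ □ ∷ □ ∷ ■ ∷ □ ∷ □ ∷ ■ ∷ [])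
     ∷ (□ ∷ □ ∷ □ ∷ □ ∷ ■ ∷ □ ∷ □ ∷ ■ ∷ [])
     ∷ (□ ∷ ■ ∷ ■ ∷ □ ∷ □ ∷ □ ∷ □ ∷ □ ∷ [])
     ∷ (□ ∷ □ ∷ □ ∷ □ ∷ □ ∷ ■ ∷ ■ ∷ □ ∷ [])
     ∷ (■ ∷ □ ∷ □ ∷ ■ ∷ □ ∷ □ ∷ □ ∷ □ ∷ [])
     ∷ (■ ∷ □ ∷ □ ∷ ■ ∷ □ ∷ □ ∷ □ ∷ □ ∷ [])
     ∷ (□ ∷ □ ∷ □ ∷ □ ∷ □ ∷ ■ ∷ ■ ∷ □ ∷ [])
     ∷ []

tileAt : Residue² → Bool
tileAt (r , s) = lookup (lookup tile s) r

-- Opaque, so that using the lemma never unfolds the exhaustive check.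
opaque
  tile-unique-neighbour : ∀ r s → ∃[ d ] (T (tileAt (shift d (r , s)))
    × (∀ e → T (tileAt (shift e (r , s))) → e ≡ d))
  tile-unique-neighbour = from-yes (all? λ r → all? λ s → any? λ d →
    T? (tileAt (shift d (r , s))) ×-dec all? λ e → T? (tileAt (shift e (r , s))) →-dec e ≟ᶠ d)

Dominoes : VSet
Dominoes v = T (tileAt (residue² v))

dominoes? : Decidable Dominoes
dominoes? v = T? (tileAt (residue² v))

dominoes-total-perfect-code : TotalPerfectCode Dominoes
dominoes-total-perfect-code v@(a , b) with tile-unique-neighbour (residue a) (residue b)
... | d , hit , unique = v ⊕ unit d , trans (dist-⊕ v (unit d)) (norm-unit d) , in-dir d hit , only
  where
  in-dir : ∀ e → T (tileAt (shift e (residue² v))) → Dominoes (v ⊕ unit e)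
  in-dir e = subst (T ∘ tileAt) (sym (residue²-unit v e))

  from-dir : ∀ e → Dominoes (v ⊕ unit e) → T (tileAt (shift e (residue² v)))
  from-dir e = subst (T ∘ tileAt) (residue²-unit v e)

  only : ∀ w → Adj v w → Dominoes w → w ≡ v ⊕ unit d
  only w adj w∈S with adj⇒unit-step v w adj
  ... | e , refl = cong (λ d′ → v ⊕ unit d′) (unique e (from-dir e w∈S))

dominoes-periodic : Periodic Dominoes
dominoes-periodic = 8 , 8 , s≤s z≤n , s≤s z≤n , λ { (a , b) v∈S →
    subst (T ∘ tileAt) (sym (cong₂ _,_ (residue-+8 a) (residue-+ 0 b))) v∈S ,
    subst (T ∘ tileAt) (sym (cong₂ _,_ (residue--8 a) (residue-+ 0 b))) v∈S ,
    subst (T ∘ tileAt) (sym (cong₂ _,_ (residue-+ 0 a) (residue-+8 b))) v∈S ,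
    subst (T ∘ tileAt) (sym (cong₂ _,_ (residue-+ 0 a) (residue--8 b))) v∈S }

dominoes-not-lattice-like : ¬ LatticeLike Dominoes
dominoes-not-lattice-like lattice-like
  with lattice-like⇒dominoes-parallel {x = + 1 , + 0} {y = + 0 , + 5} {z = unit 0F} {z′ = unit 1F}
         lattice-like (total-perfect-code⇒components-P₂ dominoes-total-perfect-code)
         refl tt tt refl tt tt
... | inj₁ ()
... | inj₂ ()

theorem11 : Σ VSet λ S → IsPDDS[P2] 1 S × Periodic S × ¬ LatticeLike S
theorem11 = Dominoes
  , total-perfect-code⇒PDDS[P₂] dominoes? dominoes-total-perfect-code
  , dominoes-periodic
  , dominoes-not-lattice-like
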